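{- Let $\mathfrak{m}\in\mathcal{P}_2(2k)$. For every nonnegative integer $l$ there is a bijection between $P(\mathfrak{m},l)$ and $\mathcal{F}(\mathfrak{m},l)$.
   Context: $\mathcal{P}_2(2k)$ is the set of pair partitions of $\{1,\dots,2k\}$; $\mathcal{P}_2(0)=\{\emptyset\}$. $S_{2k}$ acts on $\mathcal{P}_2(2k)$ by applying the permutation to every element of every block; $\mathfrak{e}=\mathfrak{e}_k=\{1,2\}\{3,4\}\cdots\{2k-1,2k\}$. The orthogonal Weingarten graph has vertex set $\bigsqcup_{k\ge0}\mathcal{P}_2(2k)$, a solid arrow $\mathfrak{m}\to(i,2k-1).\mathfrak{m}$ for every $\mathfrak{m}\in\mathcal{P}_2(2k)$ and $1\le i<2k-1$, and a dashed arrow $\mathfrak{m}\dashrightarrow\mathfrak{m}^{\downarrow}$ whenever $\{2k-1,2k\}\in\mathfrak{m}$, with $\mathfrak{m}^{\downarrow}\in\mathcal{P}_2(2k-2)$ being $\mathfrak{m}$ with that block removed. $P(\mathfrak{m},l)$ is the set of paths $(\mathfrak{m}_0=\mathfrak{m},\dots,\mathfrak{m}_{l+k}=\emptyset)$ following arrows at each step, using $l$ solid and $k$ dashed arrows. A monotone factorization of length $l$ for $\mathfrak{m}$ is a sequence $(\tau_1,\dots,\tau_l)$ of transpositions $\tau_i=(s_i,2t_i-1)$ with $1\le s_i<2t_i-1\le 2k-1$, $k\ge t_1\ge\cdots\ge t_l\ge1$, and $\mathfrak{m}=(\tau_1\cdots\tau_l).\mathfrak{e}$; $\mathcal{F}(\mathfrak{m},l)$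 is the set of these. -}

module Defs where

open import Data.Nat using (ℕ; zero; suc; _<_; _≤_)
open import Data.Fin using (Fin; zero; suc; toℕ; fromℕ; inject₁; _≟_)
open import Data.Vec using (Vec; []; _∷ʳ_; map; lookup; tabulate)
open import Data.List using (List; []; _∷_; length; allFin)
open import Data.List.Relation.Unary.All using (All)
open import Data.List.Relation.Unary.Linked using (Linked)
open import Data.Bool using (Bool; true; false; T; _∧_; not; if_then_else_)
open import Data.Product using (Σ; _×_; _,_; proj₁; proj₂)
open import Relation.Nullary.Decidable using (⌊_⌋)
open import Relation.Binary.PropositionalEquality using (_≡_)

-- dbl k = 2k (structurally, so that dbl (suc k) = suc (suc (dbl k)))
dbl : ℕ → ℕ
dbl zero = 0
dbl (suc k) = suc (suc (dbl k))

-- Points 1..2k of the paper are the elements 0..2k-1 of Fin (dbl k)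
-- (0-indexed shift).  A pair partition is encoded by its partner map,
-- given as a vector: v[i] = the other element of the block containing i.
Raw : ℕ → Set
Raw k = Vec (Fin (dbl k)) (dbl k)

allB : {A : Set} → (A → Bool) → List A → Bool
allB p [] = true
allB p (x ∷ xs) = p x ∧ allB p xs

isPairPartition : ∀ {n} → Vec (Fin n) n → Bool
isPairPartition {n} v =
  allB (λ i → ⌊ lookup v (lookup v i) ≟ i ⌋ ∧ not ⌊ lookup v i ≟ i ⌋) (allFin n)

P₂ : ℕ → Set
P₂ k = Σ (Raw k) (λ v → T (isPairPartition v))

swap : ∀ {n} → Fin n → Fin n → Fin n → Fin n
swap a b i = if ⌊ i ≟ a ⌋ then b else (if ⌊ i ≟ b ⌋ then a else i)

-- action of the transposition (a b) on a pair partition (partner map):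
-- blocks {x,y} ↦ {τx,τy}, i.e. partner' = τ ∘ partner ∘ τ  (τ = τ⁻¹)
actSwap : ∀ {n} → Fin n → Fin n → Vec (Fin n) n → Vec (Fin n) n
actSwap a b v = tabulate (λ i → swap a b (lookup v (swap a b i)))

-- m ↦ m with the extra block {2k+1, 2k+2} added (in Raw (suc k));
-- inverse of m ↦ m↓.
addTop : ∀ {k} → Raw k → Raw (suc k)
addTop {k} v =
  (map (λ x → inject₁ (inject₁ x)) v ∷ʳ fromℕ (suc (dbl k))) ∷ʳ inject₁ (fromℕ (dbl k))

-- 𝔢_k = {1,2}{3,4}⋯{2k-1,2k}
𝔢 : (k : ℕ) → Raw k
𝔢 zero = []
𝔢 (suc k) = addTop (𝔢 k)

-- the element 2k-1 (paper numbering) of {1,…,2k}, k ≥ 1, i.e. index dbl k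
top : (k : ℕ) → Fin (dbl (suc k))
top k = inject₁ (fromℕ (dbl k))

-- Paths in the orthogonal Weingarten graph from m (in 𝒫₂(2k)) to ∅,
-- using l solid arrows (and hence k dashed arrows), as sequences of arrows.
data Path : (k : ℕ) → Raw k → ℕ → Set where
  done   : Path zero [] zero
  -- solid arrow m → (i, 2k-1).m,  1 ≤ i < 2k-1  (here k replaced by suc k)
  solid  : ∀ {k m l} (i : Fin (dbl (suc k))) → toℕ i < dbl k →
           Path (suc k) (actSwap i (top k) m) l → Path (suc k) m (suc l)
  -- dashed arrow m ⇢ m↓, allowed iff {2k-1,2k} ∈ m, i.e. m = addTop m↓
  dashed : ∀ {k m l} (m↓ : Raw k) → m ≡ addTop m↓ →
           Path k m↓ l → Path (suc k) m l

P : ∀ {k} → P₂ k → ℕ → Set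
P {k} 𝔪 l = Path k (proj₁ 𝔪) l

-- the position 2t-1 (paper numbering) for t = toℕ t₀ + 1, i.e. index 2·t₀
evenPos : ∀ {k} → Fin k → Fin (dbl k)
evenPos zero = zero
evenPos (suc t) = suc (suc (evenPos t))

-- A transposition τ = (s, 2t-1) is encoded by (a , t₀) with
-- a = s - 1 : Fin (2k) and t₀ = t - 1 : Fin k (so 1 ≤ t ≤ k);
-- the condition 1 ≤ s < 2t-1 becomes toℕ a < 2·toℕ t₀.
Tr : ℕ → Set
Tr k = Fin (dbl k) × Fin k

validTr : ∀ {k} → Tr k → Set
validTr {k} (a , t) = toℕ a < toℕ (evenPos {k} t)

tGeq : ∀ {k} → Tr k → Tr k → Set
tGeq p q = toℕ (proj₂ q) ≤ toℕ (proj₂ p)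

actList : ∀ {k} → List (Tr k) → Raw k → Raw k
actList [] v = v
actList ((a , t) ∷ ts) v = actSwap a (evenPos t) (actList ts v)

ℱ : ∀ {k} → P₂ k → ℕ → Set
ℱ {k} 𝔪 l = Σ (List (Tr k)) λ ts →
  length ts ≡ l × All validTr ts × Linked tGeq ts × actList ts (𝔢 k) ≡ proj₁ 𝔪

-- Both sides unfold along a first arrow out of 𝔪 ∈ 𝒫₂(2k).  A factorization
-- τ₁ ⋯ τ_l with t₁ = k starts with the solid arrow τ₁ = (s₁, 2k−1), the rest being
-- a factorization of τ₁.𝔪.  If t₁ < k (or l = 0), monotonicity gives tᵢ < k for
-- every i, so no τᵢ moves 2k−1 or 2k; since 𝔢_k contains the block {2k−1, 2k},
-- so does 𝔪, and the same list factorizes 𝔪↓ in 𝒫₂(2k−2): this is the dashed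
-- arrow.  Matching these two cases with the two kinds of arrows and recursing
-- (on k, then on l) gives the bijection, which reads a path as the list of the
-- transpositions along its solid arrows.

module Submission where

open import Defs
open import Data.Nat using (ℕ; zero; suc; _<_; _≤_)
open import Data.Nat.Properties using (≤-refl; ≤-trans; ≤-<-trans; <-trans; <-irrefl; <-irrelevant; ≤-irrelevant)
open import Data.Fin using (Fin; zero; suc; toℕ; fromℕ; fromℕ<; inject₁; _≟_)
open import Data.Fin.Properties
  using (toℕ-injective; toℕ-fromℕ; toℕ-fromℕ<; toℕ-inject₁; toℕ<n; toℕ≤pred[n]; inject₁ℕ<; inject₁-injective; fromℕ≢inject₁)
open import Data.Fin.Relation.Unary.Top using (View; view; ‵fromℕ; ‵inj₁; ‵inject₁; view-fromℕ; view-inject₁)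
open import Data.Vec using (Vec; []; _∷_; _∷ʳ_; lookup)
import Data.Vec as Vec
open import Data.Vec.Properties using (lookup∘tabulate; tabulate∘lookup; tabulate-cong; lookup-map)
open import Data.List using (List; []; _∷_; length; map)
open import Data.List.Properties using (length-map; map-injective)
open import Data.List.Relation.Unary.All using (All; []; _∷_)
import Data.List.Relation.Unary.All as All
import Data.List.Relation.Unary.All.Properties as All
open import Data.List.Relation.Unary.Linked using (Linked; []; [-]; _∷_)
import Data.List.Relation.Unary.Linked as Linked
import Data.List.Relation.Unary.Linked.Properties as Linked
open import Data.Product using (Σ; ∃; _×_; _,_; proj₁; proj₂; Σ-syntax)
open import Data.Product.Function.Dependent.Propositional using (Σ-↔)
open import Data.Product.Function.NonDependent.Propositional using (_×-↔_)
open import Data.Sum using (_⊎_; inj₁; inj₂)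
open import Data.Sum.Function.Propositional using (_⊎-↔_)
open import Data.Empty using (⊥)
open import Function using (_∘_)
open import Function.Bundles using (_↔_; mk↔ₛ′)
open import Function.Definitions using (Injective)
open import Function.Properties.Inverse using (↔-refl; ↔-sym; ↔-trans)
open import Relation.Binary.PropositionalEquality
open import Relation.Nullary using (yes; no; contradiction)
open import Axiom.UniquenessOfIdentityProofs.WithK using (uip)

private
  variable
    k l n : ℕ

swap-fixes : {a b x : Fin n} → x ≢ a → x ≢ b → swap a b x ≡ x
swap-fixes x≢a x≢b rewrite ≢-≟-identity _≟_ x≢a | ≢-≟-identity _≟_ x≢b = refl

swap-involutive : (a b i : Fin n) → swap a b (swap a b i) ≡ i
swap-involutive a b i with i ≟ a
... | yes refl with b ≟ i
...   | yes b≡i = b≡i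
...   | no _ rewrite ≡-≟-identity _≟_ {b} refl = refl
swap-involutive a b i | no i≢a with i ≟ b
...   | yes refl rewrite ≡-≟-identity _≟_ {a} refl = refl
...   | no i≢b = swap-fixes i≢a i≢b

swap-natural : {m : ℕ} {f : Fin m → Fin n} → Injective _≡_ _≡_ f →
               (a b i : Fin m) → swap (f a) (f b) (f i) ≡ f (swap a b i)
swap-natural {f = f} f-inj a b i with i ≟ a | f i ≟ f a
... | yes _   | yes _     = refl
... | yes i≡a | no fi≢fa  = contradiction (cong f i≡a) fi≢fa
... | no i≢a  | yes fi≡fa = contradiction (f-inj fi≡fa) i≢a
... | no _    | no _ with i ≟ b | f i ≟ f b
...   | yes _   | yes _     = refl
...   | yes i≡b | no fi≢fb  = contradiction (cong f i≡b) fi≢fb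
...   | no i≢b  | yes fi≡fb = contradiction (f-inj fi≡fb) i≢b
...   | no _    | no _      = refl

lookup-extensionality : {A : Set} {xs ys : Vec A n} → (∀ i → lookup xs i ≡ lookup ys i) → xs ≡ ys
lookup-extensionality {xs = xs} {ys} eq =
  trans (sym (tabulate∘lookup xs)) (trans (tabulate-cong eq) (tabulate∘lookup ys))

actSwap-involutive : (a b : Fin n) (v : Vec (Fin n) n) → actSwap a b (actSwap a b v) ≡ v
actSwap-involutive a b v = lookup-extensionality λ i → begin
  lookup (actSwap a b (actSwap a b v)) i               ≡⟨ lookup∘tabulate _ i ⟩
  swap a b (lookup (actSwap a b v) (swap a b i))       ≡⟨ cong (swap a b) (lookup∘tabulate _ (swap a b i)) ⟩
  swap a b (swap a b (lookup v (swap a b (swap a b i)))) ≡⟨ swap-involutive a b _ ⟩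
  lookup v (swap a b (swap a b i))                     ≡⟨ cong (lookup v) (swap-involutive a b i) ⟩
  lookup v i                                           ∎
  where open ≡-Reasoning

actSwap-transpose : {a b : Fin n} {v w : Vec (Fin n) n} → actSwap a b v ≡ w → v ≡ actSwap a b w
actSwap-transpose {a = a} {b} {v} refl = sym (actSwap-involutive a b v)

-- Adding the top block {2k+1, 2k+2}

inject₂ : Fin n → Fin (suc (suc n))
inject₂ = inject₁ ∘ inject₁

inject₂-injective : Injective _≡_ _≡_ (inject₂ {n})
inject₂-injective = inject₁-injective ∘ inject₁-injective

toℕ-inject₂ : (i : Fin n) → toℕ (inject₂ i) ≡ toℕ i
toℕ-inject₂ i = trans (toℕ-inject₁ (inject₁ i)) (toℕ-inject₁ i)

lookup-∷ʳ-inject₁ : {A : Set} (xs : Vec A n) (y : A) (i : Fin n) → lookup (xs ∷ʳ y) (inject₁ i) ≡ lookup xs i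
lookup-∷ʳ-inject₁ (x ∷ xs) y zero    = refl
lookup-∷ʳ-inject₁ (x ∷ xs) y (suc i) = lookup-∷ʳ-inject₁ xs y i

lookup-∷ʳ-fromℕ : {A : Set} (xs : Vec A n) (y : A) → lookup (xs ∷ʳ y) (fromℕ n) ≡ y
lookup-∷ʳ-fromℕ []       y = refl
lookup-∷ʳ-fromℕ (x ∷ xs) y = lookup-∷ʳ-fromℕ xs y

lookup-addTop-inject₂ : (v : Raw k) (j : Fin (dbl k)) → lookup (addTop v) (inject₂ j) ≡ inject₂ (lookup v j)
lookup-addTop-inject₂ {k} v j =
  trans (lookup-∷ʳ-inject₁ (Vec.map inject₂ v ∷ʳ fromℕ (suc (dbl k))) (top k) (inject₁ j))
    (trans (lookup-∷ʳ-inject₁ (Vec.map inject₂ v) (fromℕ (suc (dbl k))) j) (lookup-map j inject₂ v))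

lookup-addTop-top : (v : Raw k) → lookup (addTop v) (top k) ≡ fromℕ (suc (dbl k))
lookup-addTop-top {k} v =
  trans (lookup-∷ʳ-inject₁ (Vec.map inject₂ v ∷ʳ fromℕ (suc (dbl k))) (top k) (fromℕ (dbl k)))
    (lookup-∷ʳ-fromℕ (Vec.map inject₂ v) (fromℕ (suc (dbl k))))

lookup-addTop-fromℕ : (v : Raw k) → lookup (addTop v) (fromℕ (suc (dbl k))) ≡ top k
lookup-addTop-fromℕ {k} v = lookup-∷ʳ-fromℕ (Vec.map inject₂ v ∷ʳ fromℕ (suc (dbl k))) (top k)

actSwap-addTop : (a b : Fin (dbl k)) (v : Raw k) →
                 actSwap (inject₂ a) (inject₂ b) (addTop v) ≡ addTop (actSwap a b v)
actSwap-addTop {k} a b v = lookup-extensionality λ i →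
  trans (lookup∘tabulate (λ i → S (lookup (addTop v) (S i))) i) (pointwise i (view i))
  where
  open ≡-Reasoning
  S = swap (inject₂ a) (inject₂ b)

  S-fixes-top : S (top k) ≡ top k
  S-fixes-top =
    swap-fixes (fromℕ≢inject₁ {i = a} ∘ inject₁-injective) (fromℕ≢inject₁ {i = b} ∘ inject₁-injective)

  S-fixes-last : S (fromℕ (suc (dbl k))) ≡ fromℕ (suc (dbl k))
  S-fixes-last = swap-fixes (fromℕ≢inject₁ {i = inject₁ a}) (fromℕ≢inject₁ {i = inject₁ b})

  at-fixed : ∀ {x y} → S x ≡ x → S y ≡ y → (∀ w → lookup (addTop w) x ≡ y) →
             S (lookup (addTop v) (S x)) ≡ lookup (addTop (actSwap a b v)) x
  at-fixed {x} {y} Sx Sy addTop[x] = begin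
    S (lookup (addTop v) (S x)) ≡⟨ cong (S ∘ lookup (addTop v)) Sx ⟩
    S (lookup (addTop v) x)     ≡⟨ cong S (addTop[x] v) ⟩
    S y                         ≡⟨ Sy ⟩
    y                           ≡⟨ addTop[x] (actSwap a b v) ⟨
    lookup (addTop (actSwap a b v)) x ∎

  pointwise : ∀ i → View i → S (lookup (addTop v) (S i)) ≡ lookup (addTop (actSwap a b v)) i
  pointwise _ ‵fromℕ          = at-fixed S-fixes-last S-fixes-top lookup-addTop-fromℕ
  pointwise _ (‵inj₁ ‵fromℕ) = at-fixed S-fixes-top S-fixes-last lookup-addTop-top
  pointwise _ (‵inj₁ (‵inject₁ j)) = begin
    S (lookup (addTop v) (S (inject₂ j)))          ≡⟨ cong (S ∘ lookup (addTop v)) (swap-natural inject₂-injective a b j) ⟩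
    S (lookup (addTop v) (inject₂ (swap a b j)))   ≡⟨ cong S (lookup-addTop-inject₂ v (swap a b j)) ⟩
    S (inject₂ (lookup v (swap a b j)))            ≡⟨ swap-natural inject₂-injective a b (lookup v (swap a b j)) ⟩
    inject₂ (swap a b (lookup v (swap a b j)))     ≡⟨ cong inject₂ (lookup∘tabulate (λ i → swap a b (lookup v (swap a b i))) j) ⟨
    inject₂ (lookup (actSwap a b v) j)             ≡⟨ lookup-addTop-inject₂ (actSwap a b v) j ⟨
    lookup (addTop (actSwap a b v)) (inject₂ j)    ∎

-- Lifting transpositions from k to k + 1

liftTr : Tr k → Tr (suc k)
liftTr (a , t) = inject₂ a , inject₁ t

liftTr-injective : Injective _≡_ _≡_ (liftTr {k})
liftTr-injective eq = cong₂ _,_ (inject₂-injective (cong proj₁ eq)) (inject₁-injective (cong proj₂ eq))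

evenPos-inject₁ : (t : Fin k) → evenPos (inject₁ t) ≡ inject₂ (evenPos t)
evenPos-inject₁ zero    = refl
evenPos-inject₁ (suc t) = cong (λ i → suc (suc i)) (evenPos-inject₁ t)

evenPos-fromℕ : ∀ k → evenPos (fromℕ k) ≡ top k
evenPos-fromℕ zero    = refl
evenPos-fromℕ (suc k) = cong (λ i → suc (suc i)) (evenPos-fromℕ k)

toℕ-evenPos-inject₁ : (t : Fin k) → toℕ (evenPos (inject₁ t)) ≡ toℕ (evenPos t)
toℕ-evenPos-inject₁ t = trans (cong toℕ (evenPos-inject₁ t)) (toℕ-inject₂ (evenPos t))

toℕ-evenPos-fromℕ : ∀ k → toℕ (evenPos (fromℕ k)) ≡ dbl k
toℕ-evenPos-fromℕ k =
  trans (cong toℕ (evenPos-fromℕ k)) (trans (toℕ-inject₁ (fromℕ (dbl k))) (toℕ-fromℕ (dbl k)))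

actList-lift : (us : List (Tr k)) (v : Raw k) → actList (map liftTr us) (addTop v) ≡ addTop (actList us v)
actList-lift []             v = refl
actList-lift ((a , t) ∷ us) v = begin
  actSwap (inject₂ a) (evenPos (inject₁ t)) (actList (map liftTr us) (addTop v))
    ≡⟨ cong₂ (actSwap (inject₂ a)) (evenPos-inject₁ t) (actList-lift us v) ⟩
  actSwap (inject₂ a) (inject₂ (evenPos t)) (addTop (actList us v))
    ≡⟨ actSwap-addTop a (evenPos t) (actList us v) ⟩
  addTop (actList ((a , t) ∷ us) v) ∎
  where open ≡-Reasoning

validTr-lift⁺ : {x : Tr k} → validTr x → validTr (liftTr x)
validTr-lift⁺ {x = a , t} = subst₂ _<_ (sym (toℕ-inject₂ a)) (sym (toℕ-evenPos-inject₁ t))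

validTr-lift⁻ : {x : Tr k} → validTr (liftTr x) → validTr x
validTr-lift⁻ {x = a , t} = subst₂ _<_ (toℕ-inject₂ a) (toℕ-evenPos-inject₁ t)

tGeq-lift⁺ : {x y : Tr k} → tGeq x y → tGeq (liftTr x) (liftTr y)
tGeq-lift⁺ {x = _ , t} {_ , s} = subst₂ _≤_ (sym (toℕ-inject₁ s)) (sym (toℕ-inject₁ t))

tGeq-lift⁻ : {x y : Tr k} → tGeq (liftTr x) (liftTr y) → tGeq x y
tGeq-lift⁻ {x = _ , t} {_ , s} = subst₂ _≤_ (toℕ-inject₁ s) (toℕ-inject₁ t)

tGeq-trans : {x y z : Tr k} → tGeq x y → tGeq y z → tGeq x z
tGeq-trans x≥y y≥z = ≤-trans y≥z x≥y

tGeq-fromℕ : (a : Fin (dbl (suc k))) (y : Tr (suc k)) → tGeq (a , fromℕ k) y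
tGeq-fromℕ {k} a (_ , s) = subst (toℕ s ≤_) (sym (toℕ-fromℕ k)) (toℕ≤pred[n] s)

liftTr-preimage : (x : Tr (suc k)) → toℕ (proj₂ x) < k → validTr x → ∃ λ y → liftTr y ≡ x
liftTr-preimage {k} (a , t) t<k a<2t with view t
... | ‵fromℕ      = contradiction (subst (_< k) (toℕ-fromℕ k) t<k) (<-irrefl refl)
... | ‵inject₁ t′ =
  (fromℕ< a<2k , t′) , cong (_, inject₁ t′) (toℕ-injective (trans (toℕ-inject₂ _) (toℕ-fromℕ< a<2k)))
  where
  a<2k : toℕ a < dbl k
  a<2k = <-trans (subst (toℕ a <_) (toℕ-evenPos-inject₁ t′) a<2t) (toℕ<n (evenPos t′))

map-preimage : {A B : Set} {f : A → B} {ys : List B} → All (λ y → ∃ λ x → f x ≡ y) ys → ∃ λ xs → map f xs ≡ ys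
map-preimage []               = [] , refl
map-preimage ((x , refl) ∷ ps) with xs , eq ← map-preimage ps = x ∷ xs , cong (_ ∷_) eq

-- Monotonicity of the t's propagates "below the top" from the head to the whole list.
map-liftTr-preimage : {a : Fin (dbl (suc k))} {t : Fin k} {ts : List (Tr (suc k))} →
                      All validTr ((a , inject₁ t) ∷ ts) → Linked tGeq ((a , inject₁ t) ∷ ts) →
                      ∃ λ us → map liftTr us ≡ (a , inject₁ t) ∷ ts
map-liftTr-preimage {k} {a} {t} {ts} valid linked =
  map-preimage (All.zipWith (λ (below , v) → liftTr-preimage _ below v) (belowTop , valid))
  where
  headBound : All (tGeq (a , inject₁ t)) ((a , inject₁ t) ∷ ts)
  -- tGeq ignores first components, so they are passed explicitly.
  headBound = Linked.Linked⇒All (λ {x} {y} {z} → tGeq-trans {x = x} {y} {z}) {v = a , inject₁ t} ≤-refl linked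
  belowTop : All (λ y → toℕ (proj₂ y) < k) ((a , inject₁ t) ∷ ts)
  belowTop = All.map (λ y≤x → ≤-<-trans y≤x (inject₁ℕ< t)) headBound

-- Unfolding paths and factorizations along their first arrow

-- ℱ 𝔪 l is Factorization k (proj₁ 𝔪) l; the unfolding below passes through
-- partner vectors that are not presented as elements of 𝒫₂.
Factorization : (k : ℕ) → Raw k → ℕ → Set
Factorization k m l = Σ (List (Tr k)) λ ts →
  length ts ≡ l × All validTr ts × Linked tGeq ts × actList ts (𝔢 k) ≡ m

Factorization-≡ : {m : Raw k} {f g : Factorization k m l} → proj₁ f ≡ proj₁ g → f ≡ g
Factorization-≡ {f = _ , le , va , li , ae} {_ , le′ , va′ , li′ , ae′} refl
  rewrite uip le le′ | uip ae ae′
        | All.irrelevant <-irrelevant va va′ | Linked.irrelevant ≤-irrelevant li li′ = refl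

Solid : (Raw (suc k) → ℕ → Set) → Raw (suc k) → ℕ → Set
Solid     X m zero    = ⊥
Solid {k} X m (suc l) = Σ[ i ∈ Fin (dbl (suc k)) ] toℕ i < dbl k × X (actSwap i (top k) m) l

Dashed : (Raw k → ℕ → Set) → Raw (suc k) → ℕ → Set
Dashed {k} Y m l = Σ[ m↓ ∈ Raw k ] m ≡ addTop m↓ × Y m↓ l

FirstArrow : (Raw (suc k) → ℕ → Set) → (Raw k → ℕ → Set) → Raw (suc k) → ℕ → Set
FirstArrow X Y m l = Solid X m l ⊎ Dashed Y m l

Path-unfold : {m : Raw (suc k)} → Path (suc k) m l ↔ FirstArrow (Path (suc k)) (Path k) m l
Path-unfold {k} = mk↔ₛ′ to from to∘from from∘to
  where
  to : ∀ {m l} → Path (suc k) m l → FirstArrow (Path (suc k)) (Path k) m l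
  to (solid i i<2k p) = inj₁ (i , i<2k , p)
  to (dashed m↓ eq p) = inj₂ (m↓ , eq , p)

  from : ∀ {m l} → FirstArrow (Path (suc k)) (Path k) m l → Path (suc k) m l
  from             (inj₂ (m↓ , eq , p))  = dashed m↓ eq p
  from {l = zero}  (inj₁ ())
  from {l = suc _} (inj₁ (i , i<2k , p)) = solid i i<2k p

  to∘from : ∀ {m l} (s : FirstArrow (Path (suc k)) (Path k) m l) → to (from s) ≡ s
  to∘from             (inj₂ _) = refl
  to∘from {l = zero}  (inj₁ ())
  to∘from {l = suc _} (inj₁ _) = refl

  from∘to : ∀ {m l} (p : Path (suc k) m l) → from (to p) ≡ p
  from∘to (solid _ _ _)  = refl
  from∘to (dashed _ _ _) = refl

Factorization-cons : {m : Raw (suc k)} → Solid (Factorization (suc k)) m l → Factorization (suc k) m l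
Factorization-cons {k} {suc _} {m} (i , i<2k , ts , refl , va , li , ae) =
  (i , fromℕ k) ∷ ts , refl , subst (toℕ i <_) (sym (toℕ-evenPos-fromℕ k)) i<2k ∷ va , linked ts li , acts
  where
  linked : ∀ ts → Linked tGeq ts → Linked tGeq ((i , fromℕ k) ∷ ts)
  linked []      _  = [-]
  linked (y ∷ _) li = tGeq-fromℕ i y ∷ li

  acts : actSwap i (evenPos (fromℕ k)) (actList ts (𝔢 (suc k))) ≡ m
  acts = trans (cong₂ (actSwap i) (evenPos-fromℕ k) ae) (actSwap-involutive i (top k) m)

Factorization-uncons : {m : Raw (suc k)} (f : Factorization (suc k) m l)
                       {a : Fin (dbl (suc k))} {ts : List (Tr (suc k))} →
                       proj₁ f ≡ (a , fromℕ k) ∷ ts → Solid (Factorization (suc k)) m l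
Factorization-uncons {k} (_ , refl , a<2t ∷ va , li , ae) {a} {ts} refl =
  a , subst (toℕ a <_) (toℕ-evenPos-fromℕ k) a<2t , ts , refl , va , Linked.tail li ,
  actSwap-transpose (trans (cong (λ b → actSwap a b (actList ts (𝔢 (suc k)))) (sym (evenPos-fromℕ k))) ae)

Factorization-lift : {m : Raw (suc k)} → Dashed (Factorization k) m l → Factorization (suc k) m l
Factorization-lift {k} (m↓ , m≡ , us , le , va , li , ae) =
  map liftTr us , trans (length-map liftTr us) le ,
  All.map⁺ (All.map validTr-lift⁺ va) , Linked.map⁺ (Linked.map (λ {x} {y} → tGeq-lift⁺ {x = x} {y}) li) ,
  trans (actList-lift us (𝔢 k)) (trans (cong addTop ae) (sym m≡))

Factorization-lower : {m : Raw (suc k)} (f : Factorization (suc k) m l) (us : List (Tr k)) →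
                      map liftTr us ≡ proj₁ f → Dashed (Factorization k) m l
Factorization-lower {k} {l} {m} (ts , le , va , li , ae) us eq =
  actList us (𝔢 k) , m≡ , us , length≡ ,
  All.map validTr-lift⁻ (All.map⁻ (subst (All validTr) (sym eq) va)) ,
  Linked.map (λ {x} {y} → tGeq-lift⁻ {x = x} {y}) (Linked.map⁻ (subst (Linked tGeq) (sym eq) li)) , refl
  where
  open ≡-Reasoning
  length≡ : length us ≡ l
  length≡ = trans (sym (length-map liftTr us)) (trans (cong length eq) le)

  m≡ : m ≡ addTop (actList us (𝔢 k))
  m≡ = begin
    m                                       ≡⟨ ae ⟨
    actList ts (𝔢 (suc k))                  ≡⟨ cong (λ ts → actList ts (𝔢 (suc k))) eq ⟨
    actList (map liftTr us) (addTop (𝔢 k))  ≡⟨ actList-lift us (𝔢 k) ⟩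
    addTop (actList us (𝔢 k))               ∎

Factorization-split : {m : Raw (suc k)} → Factorization (suc k) m l →
                      FirstArrow (Factorization (suc k)) (Factorization k) m l
Factorization-split f@([] , _) = inj₂ (Factorization-lower f [] refl)
Factorization-split f@((a , t) ∷ ts , _ , va , li , _) with view t
... | ‵fromℕ     = inj₁ (Factorization-uncons f refl)
... | ‵inject₁ _ = inj₂ (Factorization-lower f _ (proj₂ (map-liftTr-preimage va li)))

Factorization-merge : {m : Raw (suc k)} → FirstArrow (Factorization (suc k)) (Factorization k) m l →
                      Factorization (suc k) m l
Factorization-merge (inj₁ s) = Factorization-cons s
Factorization-merge (inj₂ d) = Factorization-lift d

Solid-≡ : {m : Raw (suc k)} {x y : Solid (Factorization (suc k)) m (suc l)} →
          proj₁ x ≡ proj₁ y → proj₁ (proj₂ (proj₂ x)) ≡ proj₁ (proj₂ (proj₂ y)) → x ≡ y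
Solid-≡ {x = i , i<2k , _} {_ , i<2k′ , _} refl eq =
  cong₂ (λ p f → i , p , f) (<-irrelevant i<2k i<2k′) (Factorization-≡ eq)

Dashed-≡ : {m : Raw (suc k)} {x y : Dashed (Factorization k) m l} →
           proj₁ (proj₂ (proj₂ x)) ≡ proj₁ (proj₂ (proj₂ y)) → x ≡ y
Dashed-≡ {x = _ , m≡ , _ , _ , _ , _ , refl} {_ , m≡′ , _ , _ , _ , _ , refl} refl
  rewrite uip m≡ m≡′ = cong (λ f → _ , m≡′ , f) (Factorization-≡ refl)

Factorization-cons∘uncons : {m : Raw (suc k)} (f : Factorization (suc k) m l)
                            {a : Fin (dbl (suc k))} {ts : List (Tr (suc k))} (eq : proj₁ f ≡ (a , fromℕ k) ∷ ts) →
                            Factorization-cons (Factorization-uncons f eq) ≡ f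
Factorization-cons∘uncons (_ , refl , _ ∷ _ , _ , _) refl = Factorization-≡ refl

Factorization-lower∘lift : {m : Raw (suc k)} (d : Dashed (Factorization k) m l) (us : List (Tr k))
                           (eq : map liftTr us ≡ proj₁ (Factorization-lift d)) →
                           Factorization-lower (Factorization-lift d) us eq ≡ d
Factorization-lower∘lift _ _ eq = Dashed-≡ (map-injective liftTr-injective eq)

Factorization-merge∘split : {m : Raw (suc k)} (f : Factorization (suc k) m l) →
                            Factorization-merge (Factorization-split f) ≡ f
Factorization-merge∘split ([] , _) = Factorization-≡ refl
Factorization-merge∘split f@((a , t) ∷ ts , _ , va , li , _) with view t
... | ‵fromℕ     = Factorization-cons∘uncons f refl
... | ‵inject₁ _ = Factorization-≡ (proj₂ (map-liftTr-preimage va li))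

Factorization-split∘merge : {m : Raw (suc k)} (s : FirstArrow (Factorization (suc k)) (Factorization k) m l) →
                            Factorization-split (Factorization-merge s) ≡ s
Factorization-split∘merge (inj₂ d@(_ , _ , [] , _)) = cong inj₂ (Factorization-lower∘lift d _ _)
Factorization-split∘merge (inj₂ d@(_ , _ , (_ , s) ∷ _ , _)) rewrite view-inject₁ s =
  cong inj₂ (Factorization-lower∘lift d _ _)
Factorization-split∘merge {k} {suc _} {m} (inj₁ (_ , _ , _ , refl , _)) rewrite view-fromℕ k =
  cong inj₁ (Solid-≡ {m = m} refl refl)

Factorization-unfold : {m : Raw (suc k)} →
                       Factorization (suc k) m l ↔ FirstArrow (Factorization (suc k)) (Factorization k) m l
Factorization-unfold =
  mk↔ₛ′ Factorization-split Factorization-merge Factorization-split∘merge Factorization-merge∘split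

Path₀↔Factorization₀ : Path zero [] l ↔ Factorization zero [] l
Path₀↔Factorization₀ = mk↔ₛ′ to from to∘from from∘to
  where
  to : ∀ {l} → Path zero [] l → Factorization zero [] l
  to done = [] , refl , [] , [] , refl

  from : ∀ {l} → Factorization zero [] l → Path zero [] l
  from ([] , refl , _)       = done
  from (((() , _) ∷ _) , _)

  to∘from : ∀ {l} (f : Factorization zero [] l) → to (from f) ≡ f
  to∘from ([] , refl , _)       = Factorization-≡ refl
  to∘from (((() , _) ∷ _) , _)

  from∘to : ∀ {l} (p : Path zero [] l) → from (to p) ≡ p
  from∘to done = refl

Path↔Factorization : ∀ k (m : Raw k) l → Path k m l ↔ Factorization k m l
Path↔Factorization zero    []  l = Path₀↔Factorization₀
Path↔Factorization (suc k) m   l =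
  ↔-trans Path-unfold (↔-trans (solid-arrow l ⊎-↔ dashed-arrow) (↔-sym Factorization-unfold))
  where
  solid-arrow : ∀ l → Solid (Path (suc k)) m l ↔ Solid (Factorization (suc k)) m l
  solid-arrow zero    = ↔-refl
  solid-arrow (suc l) = Σ-↔ ↔-refl (↔-refl ×-↔ Path↔Factorization (suc k) _ l)

  dashed-arrow : Dashed (Path k) m l ↔ Dashed (Factorization k) m l
  dashed-arrow = Σ-↔ ↔-refl (↔-refl ×-↔ Path↔Factorization k _ l)

lemma4p7 : (k : ℕ) (𝔪 : P₂ k) (l : ℕ) → P 𝔪 l ↔ ℱ 𝔪 l
lemma4p7 k 𝔪 l = Path↔Factorization k (proj₁ 𝔪) l
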